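{- Let $T$ and $U$ be types, $\mathbb{S}^T$ a set of semantic structures for $T$ and $\mathbb{S}^U$ a set of semantic structures for $U$. Assume that for every semantic structure $s^T \in \mathbb{S}^T$, every address $a \in s^T.A$, and every byte list $[u_a, \ldots, u_{a+s^T.\mathit{size}-1}]$ that is the result of $s^U.\mathit{to\_byte}(v)$ for some $s^U \in \mathbb{S}^U$ and $v \in s^U.V$, there is a semantic structure $s \in \mathbb{S}^T$ and an address $a' \in s.A$ such that for every sequence of bytes $(b_i)_{i=0}^\infty$, $s.\mathit{from\_byte}$ is undefined for the byte list $[b'_{a'}, \ldots, b'_{a'+s.\mathit{size}-1}]$ given by $b'_i := u_i$ for $a \leq i < a + s^T.\mathit{size}$ and $b'_i := b_i$ otherwise. Then $\mathbb{S}^T$ is type sensitive with respect to implicit casts from type $U$.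
   Context: A semantic structure for a type $T$ is a tuple $s = (V, A, \mathit{size}, \mathit{to\_byte}, \mathit{from\_byte})$ consisting of a non-empty set of values $V$, a set of addresses $A \subseteq \mathbb{N}$ (the addresses at which objects of type $T$ may be placed), a positive integer $\mathit{size}$, a total function $\mathit{to\_byte}\colon V \to \mathit{list}[\mathit{byte}]$ and a partial function $\mathit{from\_byte}\colon \mathit{list}[\mathit{byte}] \rightharpoonup V$, such that for all $v \in V$: $\mathit{length}(\mathit{to\_byte}(v)) = \mathit{size}$ and $\mathit{from\_byte}(\mathit{to\_byte}(v)) = v$. Memory is modeled as a sequence of bytes indexed by natural-number addresses; a read of type $T$ with structure $s$ at address $a' \in s.A$ applies $s.\mathit{from\_byte}$ to the bytes at addresses $a', \ldots, a'+s.\mathit{size}-1$, and if $\mathit{from\_byte}$ is undefined there the semantics gets stuck (the program does not terminate normally). $\mathbb{S}^T$ is the set of admissible semantic structures for $T$; program verification is carried out against an arbitrary but fixed structure in $\mathbb{S}^T$ for each type, so a program is verified to terminate normally only if it does so for every such choice. Memory modifications are assumed to occur at fixed addresses independent of the choice of semantic structure for $T$, and the object representation for $U$ is assumed not to depend on the choice of semantic structure for $T$; only reads by $s^T \in \mathbb{S}^T$ that read exactly one object representation produced by some $s^U \in \mathbb{S}^U$ are considered. For a structure $s^T$ and an address $a$, the class of implicit-cast modifications from $U$ (with $U \neq T$) consists of all memory modifications that write a complete object representation $s^U.\mathit{to\_byte}(v)$ of some $s^U \in \mathbb{S}^U$ with $s^U.\mathit{size} = s^T.\mathit{size}$ at $a$.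 $\mathbb{S}^T$ is type sensitive with respect to a class $\mathcal{C}$ of memory modifications if provable normal program termination (for all choices of semantic structures) implies that memory read with type $T$ was not changed by modifications in $\mathcal{C}$. -}

module Defs where

open import Data.Nat using (ℕ; zero; suc; _+_; _<_; _≤_; _∸_)
open import Data.Nat.Properties using (_≟_)
open import Data.Fin using (Fin)
open import Data.List using (List; []; _∷_; _++_; length; map; upTo)
open import Data.List.Relation.Unary.All using (All)
open import Data.Vec using (Vec; toList)
open import Data.Empty using (⊥)
open import Data.Maybe using (Maybe; just; nothing)
open import Data.Product using (Σ; ∃; _×_; _,_)
open import Relation.Nullary using (¬_; yes; no)
open import Relation.Binary.PropositionalEquality using (_≡_)

Byte : Set
Byte = Fin 256

Memory : Set
Memory = ℕ → Byte

readMem : Memory → ℕ → ℕ → List Byte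
readMem m a n = map (λ i → m (a + i)) (upTo n)

writeMem : Memory → ℕ → List Byte → Memory
writeMem m a []       = m
writeMem m a (x ∷ xs) i with i ≟ a
... | yes _ = x
... | no  _ = writeMem m (suc a) xs i

record SemStruct : Set₁ where
  field
    V        : Set
    v₀       : V                      -- V is non-empty
    A        : ℕ → Set
    size     : ℕ
    size>0   : 0 < size
    toByte   : V → List Byte
    fromByte : List Byte → Maybe V    -- partial (nothing = undefined)
    toByte-length : ∀ v → length (toByte v) ≡ size
    from-to  : ∀ v → fromByte (toByte v) ≡ just v
open SemStruct public

-- A program is run against a chosen semantic structure s for T and a
-- placement address p ∈ s.A of the object of type T.  Memory
-- modifications occur at fixed addresses independent of s; their
-- contents may depend on s (e.g. writes of T values) unless they are
-- fixed byte lists (e.g. object representations of U values, which do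
-- not depend on the structure chosen for T).

data Instr : Set₁ where
  write    : (a : ℕ) → List Byte → Instr
  writeDep : (a n : ℕ) → (SemStruct → ℕ → Vec Byte n) → Instr
  readT    : Instr

Program : Set₁
Program = List Instr

-- Execution; nothing = the semantics gets stuck.
run : SemStruct → ℕ → Memory → Program → Maybe Memory
run s p m []                     = just m
run s p m (write a bs ∷ P)       = run s p (writeMem m a bs) P
run s p m (writeDep a n f ∷ P)   = run s p (writeMem m a (toList (f s p))) P
run s p m (readT ∷ P) with fromByte s (readMem m p (size s))
... | nothing = nothing
... | just _  = run s p m P

TerminatesNormally : SemStruct → ℕ → Memory → Program → Set
TerminatesNormally s p m P = ∃ λ m' → run s p m P ≡ just m'

ProvablyTerminates : (SemStruct → Set) → Program → Set₁
ProvablyTerminates 𝕊T P =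
  ∀ s → 𝕊T s → ∀ p → A s p → ∀ m → TerminatesNormally s p m P

Overlaps : ℕ → ℕ → Instr → Set
Overlaps p n (write a bs)       = (a < p + n) × (p < a + length bs)
Overlaps p n (writeDep a k f)   = (a < p + n) × (p < a + k)
Overlaps p n readT              = ⊥

ModClass : Set₂
ModClass = SemStruct → ℕ → Instr → Set₁

ReadsFromClass : ModClass → SemStruct → ℕ → Program → Set₁
ReadsFromClass C s p P =
  Σ Program λ P₀ → Σ Instr λ c → Σ Program λ P₁ → Σ Program λ P₂ →
    (P ≡ P₀ ++ c ∷ P₁ ++ readT ∷ P₂)
    × C s p c
    × All (λ i → ¬ Overlaps p (size s) i) P₁

TypeSensitive : (SemStruct → Set) → ModClass → Set₁
TypeSensitive 𝕊T C =
  ∀ (P : Program) → ProvablyTerminates 𝕊T P →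
  ∀ s → 𝕊T s → ∀ p → A s p → ¬ ReadsFromClass C s p P

ImplicitCast : (SemStruct → Set) → ModClass
ImplicitCast 𝕊U sT a c =
  Σ SemStruct λ sU → 𝕊U sU × (size sU ≡ size sT) ×
    Σ (V sU) λ v → c ≡ write a (toByte sU v)

-- Run the program under the structure s and address a' supplied by the hypothesis.  Memory
-- modifications sit at the same addresses and the bytes of the U object do not depend on the
-- structure for T, so the cast still stores those bytes at a, and the writes between the cast
-- and the read do not touch them.  The read under s therefore sees a memory of the shape
-- writeMem b a (toByte sU v), on which s.from_byte is undefined: the program gets stuck under
-- an admissible structure, contradicting provable termination.
module Submission where

open import Defs
open import Data.Maybe using (just; nothing)
open import Data.Product using (Σ; _×_; _,_)
open import Relation.Nullary using (¬_; yes; no; Dec)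
open import Relation.Nullary.Decidable using (_×-dec_)
open import Relation.Binary.PropositionalEquality
  using (_≡_; _≢_; refl; sym; trans; cong; subst; module ≡-Reasoning)

open import Data.Nat using (ℕ; suc; _+_; _≤_; _<_; _≤?_; _<?_; s≤s; z≤n)
open import Data.Nat.Properties
  using (_≟_; ≤-refl; <⇒≤; <⇒≱; ≤∧≢⇒<; ≤-<-trans; m<m+n; +-suc; +-identityʳ)
open import Data.Fin using (zero)
open import Data.List using (List; []; _∷_; _++_; length; upTo)
open import Data.List.Properties using (map-cong)
open import Data.List.Relation.Unary.All using (All; []; _∷_)
open import Data.Vec using (toList)
open import Data.Vec.Properties using (length-toList)
open import Data.Empty using (⊥-elim)

InRange : ℕ → ℕ → ℕ → Set
InRange a n i = a ≤ i × i < a + n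

inRange? : ∀ a n i → Dec (InRange a n i)
inRange? a n i = (a ≤? i) ×-dec (i <? a + n)

writeMem-outside : ∀ m a bs i → ¬ InRange a (length bs) i → writeMem m a bs i ≡ m i
writeMem-outside m a []       i _ = refl
writeMem-outside m a (x ∷ xs) i out with i ≟ a
... | yes refl = ⊥-elim (out (≤-refl , m<m+n a (s≤s z≤n)))
... | no  _    = writeMem-outside m (suc a) xs i λ (a<i , i<) →
  out (<⇒≤ a<i , subst (i <_) (sym (+-suc a (length xs))) i<)

writeMem-inside : ∀ m m′ a bs i → InRange a (length bs) i →
  writeMem m a bs i ≡ writeMem m′ a bs i
writeMem-inside m m′ a []       i (a≤i , i<) = ⊥-elim (<⇒≱ (subst (i <_) (+-identityʳ a) i<) a≤i)
writeMem-inside m m′ a (x ∷ xs) i (a≤i , i<) with i ≟ a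
... | yes _  = refl
... | no i≢a = writeMem-inside m m′ (suc a) xs i
  (≤∧≢⇒< a≤i (λ a≡i → i≢a (sym a≡i)) , subst (i <_) (+-suc a (length xs)) i<)

-- Memory m already holds bs at p: writing bs there changes nothing.
Stores : Memory → ℕ → List Byte → Set
Stores m p bs = ∀ i → writeMem m p bs i ≡ m i

writeMem-stores : ∀ m p bs → Stores (writeMem m p bs) p bs
writeMem-stores m p bs i with inRange? p (length bs) i
... | yes inside  = writeMem-inside _ m p bs i inside
... | no  outside = writeMem-outside _ p bs i outside

writeMem-preserves-stores : ∀ m p bs q cs →
  ¬ (q < p + length bs × p < q + length cs) →
  Stores m p bs → Stores (writeMem m q cs) p bs
writeMem-preserves-stores m p bs q cs disjoint stores i with inRange? q (length cs) i
... | yes (q≤i , i<) = writeMem-outside _ p bs i λ (p≤i , i<′) →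
  disjoint (≤-<-trans q≤i i<′ , ≤-<-trans p≤i i<)
... | no notInCs with inRange? p (length bs) i
...   | no  outside = writeMem-outside _ p bs i outside
...   | yes inside  = begin
  writeMem (writeMem m q cs) p bs i ≡⟨ writeMem-inside _ m p bs i inside ⟩
  writeMem m p bs i                 ≡⟨ stores i ⟩
  m i                               ≡⟨ sym (writeMem-outside m q cs i notInCs) ⟩
  writeMem m q cs i                 ∎
  where open ≡-Reasoning

readMem-cong : ∀ {m m′ : Memory} → (∀ i → m i ≡ m′ i) → ∀ a n → readMem m a n ≡ readMem m′ a n
readMem-cong m≗m′ a n = map-cong (λ i → m≗m′ (a + i)) (upTo n)

run-suffix-stuck : ∀ s p P {Q} → (∀ m → run s p m Q ≡ nothing) →
  ∀ m → run s p m (P ++ Q) ≡ nothing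
run-suffix-stuck s p []                   stuck m = stuck m
run-suffix-stuck s p (write a bs ∷ P)     stuck m = run-suffix-stuck s p P stuck _
run-suffix-stuck s p (writeDep a n f ∷ P) stuck m = run-suffix-stuck s p P stuck _
run-suffix-stuck s p (readT ∷ P)          stuck m with fromByte s (readMem m p (size s))
... | nothing = refl
... | just _  = run-suffix-stuck s p P stuck m

run-stuck-at-read : ∀ s q p bs P₁ P₂ →
  (∀ M → Stores M p bs → fromByte s (readMem M q (size s)) ≡ nothing) →
  All (λ c → ¬ Overlaps p (length bs) c) P₁ →
  ∀ m → Stores m p bs → run s q m (P₁ ++ readT ∷ P₂) ≡ nothing
run-stuck-at-read s q p bs [] P₂ unreadable [] m stores
  rewrite unreadable m stores = refl
run-stuck-at-read s q p bs (write a cs ∷ P₁) P₂ unreadable (disjoint ∷ rest) m stores =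
  run-stuck-at-read s q p bs P₁ P₂ unreadable rest _
    (writeMem-preserves-stores m p bs a cs disjoint stores)
run-stuck-at-read s q p bs (writeDep a k f ∷ P₁) P₂ unreadable (disjoint ∷ rest) m stores =
  run-stuck-at-read s q p bs P₁ P₂ unreadable rest _
    (writeMem-preserves-stores m p bs a (toList (f s q))
      (subst (λ k → ¬ (a < p + length bs × p < a + k)) (sym (length-toList (f s q))) disjoint)
      stores)
run-stuck-at-read s q p bs (readT ∷ P₁) P₂ unreadable (_ ∷ rest) m stores
  with fromByte s (readMem m q (size s))
... | nothing = refl
... | just _  = run-stuck-at-read s q p bs P₁ P₂ unreadable rest m stores

lemma3 : {Ty : Set} (T U : Ty) → ¬ (U ≡ T) → (𝕊 : Ty → SemStruct → Set) →
    (∀ sT → 𝕊 T sT → ∀ a → A sT a →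
      ∀ sU → 𝕊 U sU → ∀ (v : V sU) → size sU ≡ size sT →
      Σ SemStruct λ s → 𝕊 T s × Σ _ λ a' → A s a' ×
        (∀ (b : Memory) →
          fromByte s (readMem (writeMem b a (toByte sU v)) a' (size s)) ≡ nothing)) →
    TypeSensitive (𝕊 T) (ImplicitCast (𝕊 U))
lemma3 T U _ 𝕊 hyp P terminates sT sT∈𝕊 p p∈A
       (P₀ , _ , P₁ , P₂ , refl , (sU , sU∈𝕊 , sameSize , v , refl) , untouched)
  with hyp sT sT∈𝕊 p p∈A sU sU∈𝕊 v sameSize
... | s , s∈𝕊 , q , q∈A , unreadable
  with terminates s s∈𝕊 q q∈A (λ _ → zero)
... | m′ , runs = nothing≢just (trans (sym stuck) runs)
  where
    bs : List Byte
    bs = toByte sU v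

    untouched′ : All (λ c → ¬ Overlaps p (length bs) c) P₁
    untouched′ = subst (λ n → All (λ c → ¬ Overlaps p n c) P₁)
      (sym (trans (toByte-length sU v) sameSize)) untouched

    unreadable′ : ∀ M → Stores M p bs → fromByte s (readMem M q (size s)) ≡ nothing
    unreadable′ M stores =
      trans (cong (fromByte s) (sym (readMem-cong stores q (size s)))) (unreadable M)

    stuck : run s q (λ _ → zero) (P₀ ++ write p bs ∷ P₁ ++ readT ∷ P₂) ≡ nothing
    stuck = run-suffix-stuck s q P₀
      (λ m → run-stuck-at-read s q p bs P₁ P₂ unreadable′ untouched′ _ (writeMem-stores m p bs)) _

    nothing≢just : ∀ {x : Memory} → nothing ≢ just x
    nothing≢just ()
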